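{- Let $d,\ell \geq 2$ be integers and let $H$ be a bipartite graph with bipartition $X,Y$ that has no induced subgraph isomorphic to $dK_2$ and no induced subgraph isomorphic to $K_{\ell,\ell}$. Suppose that $\deg(x) \geq \ell^{d-1}$ for every $x \in X$. Then $|X| \leq \binom{d}{2}(\ell-1)$.
   Context: $dK_2$ denotes the disjoint union of $d$ copies of $K_2$ (equivalently, an induced matching with $d$ edges). $K_{\ell,\ell}$ is the complete bipartite graph with both parts of size $\ell$. Graphs are finite and simple. -}

module Defs where

open import Data.Nat using (ℕ)
open import Data.Fin using (Fin)
open import Data.Fin.Properties using (_≟_)
open import Data.Sum using (_⊎_; inj₁; inj₂)
open import Data.Bool using (Bool; true; false)
open import Data.Product using (Σ; _×_)
open import Data.List using (length; filterᵇ; allFin)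
open import Relation.Nullary.Decidable using (⌊_⌋)
open import Relation.Binary.PropositionalEquality using (_≡_; refl)
open import Function.Definitions using (Injective)

record Graph (V : Set) : Set where
  field
    adj    : V → V → Bool
    sym    : ∀ u v → adj u v ≡ adj v u
    irrefl : ∀ v → adj v v ≡ false
open Graph public

bipAdj : {A B : Set} → (A → B → Bool) → A ⊎ B → A ⊎ B → Bool
bipAdj R (inj₁ a) (inj₁ a′) = false
bipAdj R (inj₁ a) (inj₂ b)  = R a b
bipAdj R (inj₂ b) (inj₁ a)  = R a b
bipAdj R (inj₂ b) (inj₂ b′) = false

bipSym : {A B : Set} (R : A → B → Bool) → ∀ u v → bipAdj R u v ≡ bipAdj R v u
bipSym R (inj₁ a) (inj₁ a′) = refl
bipSym R (inj₁ a) (inj₂ b)  = refl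
bipSym R (inj₂ b) (inj₁ a)  = refl
bipSym R (inj₂ b) (inj₂ b′) = refl

bipIrr : {A B : Set} (R : A → B → Bool) → ∀ v → bipAdj R v v ≡ false
bipIrr R (inj₁ a) = refl
bipIrr R (inj₂ b) = refl

bipartite : {A B : Set} → (A → B → Bool) → Graph (A ⊎ B)
bipartite R = record { adj = bipAdj R ; sym = bipSym R ; irrefl = bipIrr R }

InducedCopy : {U V : Set} → Graph U → Graph V → Set
InducedCopy {U} {V} F G =
  Σ (U → V) λ f → Injective _≡_ _≡_ f × (∀ u v → adj G (f u) (f v) ≡ adj F u v)

matchingGraph : (d : ℕ) → Graph (Fin d ⊎ Fin d)
matchingGraph d = bipartite (λ i j → ⌊ i ≟ j ⌋)

completeBipartite : (ℓ : ℕ) → Graph (Fin ℓ ⊎ Fin ℓ)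
completeBipartite ℓ = bipartite (λ _ _ → true)

degX : {m n : ℕ} → (Fin m → Fin n → Bool) → Fin m → ℕ
degX {n = n} R x = length (filterᵇ (R x) (allFin n))

{-# OPTIONS --safe #-}
module Submission where

-- The induced matching is built greedily. A partial matching consists of centres
-- x₁,…,x_j ∈ X, for each centre a reserve W_i ⊆ N(x_i) meeting no other N(x_i′), and a
-- pool F ⊆ Y adjacent to no centre. When r + 1 more edges are wanted, a candidate is a
-- vertex with at least ℓ^r neighbours in F and at least ℓ^r non-neighbours in every W_i;
-- at the start every vertex of X is one. Adding the candidate x with fewest neighbours in F
-- (new reserve F ∩ N(x), while F and the old reserves lose N(x)) leaves reserves of
-- size ≥ ℓ^r. Fewer than ℓ vertices miss fewer than ℓ^(r-1) vertices of a set of size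
-- ≥ ℓ^r, since ℓ of them would have ℓ common neighbours there, an induced K_{ℓ,ℓ}; and
-- by the choice of x, a candidate with fewer than ℓ^(r-1) neighbours in the new pool
-- misses fewer than ℓ^(r-1) vertices of the new reserve. So when the j-th centre is
-- added at most j(ℓ-1) candidates are lost, (1 + ⋯ + (d-1))(ℓ-1) = C(d,2)(ℓ-1) in all,
-- and if |X| exceeded this the process would end with an induced dK₂.

open import Defs hiding (sym)
open import Data.Nat using (ℕ; zero; suc; pred; _+_; _*_; _^_; _∸_; _≤_; _<_; _≤?_; _<?_; z≤n; s≤s)
open import Data.Nat.Properties
  using ( +-suc; +-assoc; +-comm; +-identityʳ; *-distribʳ-+
        ; ≤-refl; ≤-trans; ≤-pred; m≤n⇒m≤1+n; ≮⇒≥; ≰⇒>; <⇒≤pred; <-≤-trans; ≤-<-trans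
        ; +-mono-≤; +-monoˡ-≤; +-monoʳ-≤; +-cancelˡ-≤; +-cancelˡ-<; module ≤-Reasoning )
open import Data.Nat.Combinatorics using (_C_; nC1≡n; nCk+nC[k+1]≡[n+1]C[k+1])
open import Data.Nat.Tactic.RingSolver using (solve-∀)
open import Data.Bool using (Bool; true; false; _∧_; not; if_then_else_)
open import Data.Bool.Properties using (∧-conicalˡ; ∧-conicalʳ; not-injective)
import Data.Bool.Properties as Bool
open import Data.Fin using (Fin; zero; suc; lift)
open import Data.Fin.Properties using (_≟_; ¬Fin0; any?; all?; ¬∀⟶∃¬; lift-injective; suc-injective)
open import Data.Vec.Functional using (_∷_)
open import Data.List using (length; filterᵇ; tabulate)
open import Data.Sum using (inj₁; inj₂)
import Data.Sum as Sum
open import Data.Sum.Properties using (inj₁-injective; inj₂-injective)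
open import Data.Product using (Σ-syntax; ∃; _×_; _,_; proj₁; proj₂)
open import Function using (_∘_; id)
open import Function.Definitions using (Injective)
open import Relation.Nullary using (Dec; yes; no; ¬_; contradiction)
open import Relation.Nullary.Decidable using (⌊_⌋; _×-dec_)
open import Relation.Unary using (Decidable)
open import Relation.Binary.PropositionalEquality

private variable
  j k m n K b : ℕ
  X Y : Set
  x : Fin k
  A B : Fin k → Bool

⌊⌋-sound : ∀ {P : Set} (p? : Dec P) → ⌊ p? ⌋ ≡ true → P
⌊⌋-sound (yes p) _ = p

⌊⌋-complete : ∀ {P : Set} (p? : Dec P) → P → ⌊ p? ⌋ ≡ true
⌊⌋-complete (yes _) _ = refl
⌊⌋-complete (no ¬p) p = contradiction p ¬p

⌊⌋-false⇒¬ : ∀ {P : Set} (p? : Dec P) → ⌊ p? ⌋ ≡ false → ¬ P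
⌊⌋-false⇒¬ (no ¬p) _ = ¬p

infix  4 _∈_ _⊆_
infixl 7 _∩_ _∖_

_∈_ : Fin k → (Fin k → Bool) → Set
x ∈ A = A x ≡ true

_⊆_ : (Fin k → Bool) → (Fin k → Bool) → Set
A ⊆ B = ∀ x → x ∈ A → x ∈ B

⊤ : Fin k → Bool
⊤ _ = true

_∩_ _∖_ : (Fin k → Bool) → (Fin k → Bool) → Fin k → Bool
(A ∩ B) x = A x ∧ B x
(A ∖ B) x = A x ∧ not (B x)

-- A x ∧ B x does not determine A and B, so the destructors take the sets explicitly.

∈-∩⁻ : ∀ (A B : Fin k → Bool) → x ∈ A ∩ B → x ∈ A × x ∈ B
∈-∩⁻ {x = x} A B p = ∧-conicalˡ (A x) (B x) p , ∧-conicalʳ (A x) (B x) p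

∈-∖⁻ : ∀ (A B : Fin k → Bool) → x ∈ A ∖ B → x ∈ A × B x ≡ false
∈-∖⁻ {x = x} A B p = ∧-conicalˡ (A x) _ p , not-injective (∧-conicalʳ (A x) _ p)

p∩q⊆p : ∀ (A B : Fin k → Bool) → A ∩ B ⊆ A
p∩q⊆p A B _ x∈A∩B = proj₁ (∈-∩⁻ A B x∈A∩B)

p∩q⊆q : ∀ (A B : Fin k → Bool) → A ∩ B ⊆ B
p∩q⊆q A B _ x∈A∩B = proj₂ (∈-∩⁻ A B x∈A∩B)

∖-monoˡ : ∀ (D : Fin k → Bool) → A ⊆ B → A ∖ D ⊆ B ∖ D
∖-monoˡ {A = A} D A⊆B x x∈A∖D with x∈A , x∉D ← ∈-∖⁻ A D x∈A∖D =
  cong₂ _∧_ (A⊆B x x∈A) (cong not x∉D)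

∣_∣ : (Fin k → Bool) → ℕ
∣_∣ {zero}  A = 0
∣_∣ {suc k} A = if A zero then suc ∣ A ∘ suc ∣ else ∣ A ∘ suc ∣

∣⊤∣≡k : ∣ ⊤ {k} ∣ ≡ k
∣⊤∣≡k {zero}  = refl
∣⊤∣≡k {suc k} = cong suc ∣⊤∣≡k

∣∣-cong : A ≗ B → ∣ A ∣ ≡ ∣ B ∣
∣∣-cong {zero}  A≗B = refl
∣∣-cong {suc k} {A} {B} A≗B
  rewrite A≗B zero | ∣∣-cong {A = A ∘ suc} {B ∘ suc} (A≗B ∘ suc) = refl

∣A∣≡∣A∩B∣+∣A∖B∣ : ∀ (A B : Fin k → Bool) → ∣ A ∣ ≡ ∣ A ∩ B ∣ + ∣ A ∖ B ∣
∣A∣≡∣A∩B∣+∣A∖B∣ {zero}  A B = refl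
∣A∣≡∣A∩B∣+∣A∖B∣ {suc k} A B with A zero | B zero | ∣A∣≡∣A∩B∣+∣A∖B∣ (A ∘ suc) (B ∘ suc)
... | true  | true  | ih = cong suc ih
... | true  | false | ih = trans (cong suc ih) (sym (+-suc _ _))
... | false | _     | ih = ih

p⊆q⇒∣p∣≤∣q∣ : A ⊆ B → ∣ A ∣ ≤ ∣ B ∣
p⊆q⇒∣p∣≤∣q∣ {zero}  A⊆B = z≤n
p⊆q⇒∣p∣≤∣q∣ {suc k} {A} {B} A⊆B
  with A zero in A₀ | B zero in B₀ | p⊆q⇒∣p∣≤∣q∣ {A = A ∘ suc} {B ∘ suc} (A⊆B ∘ suc)
... | true  | true  | ih = s≤s ih
... | true  | false | ih with () ← trans (sym B₀) (A⊆B zero A₀)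
... | false | true  | ih = m≤n⇒m≤1+n ih
... | false | false | ih = ih

∣∣>0⇒nonempty : ∀ (A : Fin k → Bool) → 0 < ∣ A ∣ → ∃ (_∈ A)
∣∣>0⇒nonempty {suc k} A ∣A∣>0 with A zero in A₀
... | true  = zero , A₀
... | false with x , x∈A ← ∣∣>0⇒nonempty (A ∘ suc) ∣A∣>0 = suc x , x∈A

Selection : ℕ → (Fin n → Bool) → Set
Selection {n} k A = Σ[ g ∈ (Fin k → Fin n) ] Injective _≡_ _≡_ g × (∀ i → g i ∈ A)

select : ∀ k (A : Fin n → Bool) → k ≤ ∣ A ∣ → Selection k A
select zero A _ = (λ ()) , (λ { {()} }) , λ ()
select {suc n} (suc k) A k<∣A∣ with A zero in A₀
... | true with g , g-inj , g∈A ← select k (A ∘ suc) (≤-pred k<∣A∣) =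
  lift 1 g , lift-injective g g-inj 1 , λ { zero → A₀ ; (suc i) → g∈A i }
... | false with g , g-inj , g∈A ← select (suc k) (A ∘ suc) k<∣A∣ =
  suc ∘ g , g-inj ∘ suc-injective , g∈A

Minimiser : (Fin k → Bool) → (Fin k → ℕ) → Set
Minimiser {k} A f = Σ[ x ∈ Fin k ] x ∈ A × (∀ {y} → y ∈ A → f x ≤ f y)

minimiser : ∀ (A : Fin k → Bool) (f : Fin k → ℕ) → x ∈ A → Minimiser A f
minimiser {x = x} A f x∈A = descend (suc (f x)) x∈A ≤-refl
  where
  descend : ∀ b {x} → x ∈ A → f x < b → Minimiser A f
  descend (suc b) {x} x∈A fx<b with any? (λ y → (A y Bool.≟ true) ×-dec (f y <? f x))
  ... | yes (y , y∈A , fy<fx) = descend b y∈A (<-≤-trans fy<fx (≤-pred fx<b))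
  ... | no ∄lower = x , x∈A , λ y∈A → ≮⇒≥ (λ fy<fx → ∄lower (_ , y∈A , fy<fx))

∣∣-≤-cover : ∀ (Q : Fin K → Fin k → Bool) → (∀ {x} → x ∈ A → ∃ λ i → x ∈ Q i) →
             (∀ i → ∣ Q i ∣ ≤ b) → ∣ A ∣ ≤ K * b
∣∣-≤-cover {zero} {A = A} Q cover _ =
  ≮⇒≥ λ ∣A∣>0 → ¬Fin0 (proj₁ (cover (proj₂ (∣∣>0⇒nonempty A ∣A∣>0))))
∣∣-≤-cover {suc K} {A = A} {b} Q cover ∣Q∣≤b = begin
  ∣ A ∣                           ≡⟨ ∣A∣≡∣A∩B∣+∣A∖B∣ A (Q zero) ⟩
  ∣ A ∩ Q zero ∣ + ∣ A ∖ Q zero ∣ ≤⟨ +-mono-≤ (≤-trans (p⊆q⇒∣p∣≤∣q∣ (p∩q⊆q A (Q zero))) (∣Q∣≤b zero))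
                                             (∣∣-≤-cover (Q ∘ suc) cover′ (∣Q∣≤b ∘ suc)) ⟩
  b + K * b                       ∎
  where
  open ≤-Reasoning
  cover′ : ∀ {x} → x ∈ A ∖ Q zero → ∃ λ i → x ∈ Q (suc i)
  cover′ x∈A∖Q₀ with x∈A , x∉Q₀ ← ∈-∖⁻ A (Q zero) x∈A∖Q₀ | cover x∈A
  ... | zero  , x∈Q₀ with () ← trans (sym x∉Q₀) x∈Q₀
  ... | suc i , x∈Qᵢ = i , x∈Qᵢ

∣∩∖∣≤∣∖∩∣ : ∀ (F A B : Fin k → Bool) → ∣ F ∩ A ∣ ≤ ∣ F ∩ B ∣ → ∣ F ∩ A ∖ B ∣ ≤ ∣ F ∖ A ∩ B ∣
∣∩∖∣≤∣∖∩∣ F A B ∣F∩A∣≤∣F∩B∣ = +-cancelˡ-≤ ∣ F ∩ A ∩ B ∣ _ _ (begin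
  ∣ F ∩ A ∩ B ∣ + ∣ F ∩ A ∖ B ∣ ≡⟨ ∣A∣≡∣A∩B∣+∣A∖B∣ (F ∩ A) B ⟨
  ∣ F ∩ A ∣                     ≤⟨ ∣F∩A∣≤∣F∩B∣ ⟩
  ∣ F ∩ B ∣                     ≡⟨ ∣A∣≡∣A∩B∣+∣A∖B∣ (F ∩ B) A ⟩
  ∣ F ∩ B ∩ A ∣ + ∣ F ∩ B ∖ A ∣ ≡⟨ cong₂ _+_ (∣∣-cong λ y → xy∙z≈xz∙y (F y) (B y) (A y))
                                              (∣∣-cong λ y → xy∙z≈xz∙y (F y) (B y) (not (A y))) ⟩
  ∣ F ∩ A ∩ B ∣ + ∣ F ∖ A ∩ B ∣ ∎)
  where
  open ≤-Reasoning
  open import Algebra.Bundles using (CommutativeMonoid)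
  open import Algebra.Properties.CommutativeSemigroup
    (CommutativeMonoid.commutativeSemigroup Bool.∧-commutativeMonoid) using (xy∙z≈xz∙y)

degX≡∣R∣ : ∀ {m} (R : Fin m → Fin n → Bool) x → degX R x ≡ ∣ R x ∣
degX≡∣R∣ R x = length-filter-tabulate (R x) id
  where
  length-filter-tabulate : ∀ {k} {V : Set} (P : V → Bool) (f : Fin k → V) →
                           length (filterᵇ P (tabulate f)) ≡ ∣ P ∘ f ∣
  length-filter-tabulate {zero}  P f = refl
  length-filter-tabulate {suc k} P f with P (f zero)
  ... | true  = cong suc (length-filter-tabulate P (f ∘ suc))
  ... | false = length-filter-tabulate P (f ∘ suc)

bipartiteCopy : ∀ {A B : Set} {S : A → B → Bool} {R : X → Y → Bool} (f : A → X) (g : B → Y) →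
  Injective _≡_ _≡_ f → Injective _≡_ _≡_ g → (∀ a b → R (f a) (g b) ≡ S a b) →
  InducedCopy (bipartite S) (bipartite R)
bipartiteCopy {S = S} {R} f g f-inj g-inj f×g-adj = Sum.map f g , map-inj , map-adj
  where
  map-inj : Injective _≡_ _≡_ (Sum.map f g)
  map-inj {inj₁ a} {inj₁ a′} eq = cong inj₁ (f-inj (inj₁-injective eq))
  map-inj {inj₂ b} {inj₂ b′} eq = cong inj₂ (g-inj (inj₂-injective eq))
  map-adj : ∀ u v → bipAdj R (Sum.map f g u) (Sum.map f g v) ≡ bipAdj S u v
  map-adj (inj₁ a) (inj₁ a′) = refl
  map-adj (inj₁ a) (inj₂ b)  = f×g-adj a b
  map-adj (inj₂ b) (inj₁ a)  = f×g-adj a b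
  map-adj (inj₂ b) (inj₂ b′) = refl

inducedMatching : ∀ {R : X → Y → Bool} (f : Fin j → X) (g : Fin j → Y) →
  (∀ a b → R (f a) (g b) ≡ ⌊ a ≟ b ⌋) → InducedCopy (matchingGraph j) (bipartite R)
inducedMatching {R = R} f g f×g-adj = bipartiteCopy f g f-inj g-inj f×g-adj
  where
  matched : ∀ a → R (f a) (g a) ≡ true
  matched a = trans (f×g-adj a a) (⌊⌋-complete (a ≟ a) refl)
  f-inj : Injective _≡_ _≡_ f
  f-inj {a} {b} fa≡fb = sym (⌊⌋-sound (b ≟ a) (begin
    ⌊ b ≟ a ⌋     ≡⟨ f×g-adj b a ⟨
    R (f b) (g a) ≡⟨ cong (λ x → R x (g a)) fa≡fb ⟨
    R (f a) (g a) ≡⟨ matched a ⟩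
    true          ∎))
    where open ≡-Reasoning
  g-inj : Injective _≡_ _≡_ g
  g-inj {a} {b} ga≡gb = ⌊⌋-sound (a ≟ b) (begin
    ⌊ a ≟ b ⌋     ≡⟨ f×g-adj a b ⟨
    R (f a) (g b) ≡⟨ cong (R (f a)) ga≡gb ⟨
    R (f a) (g a) ≡⟨ matched a ⟩
    true          ∎)
    where open ≡-Reasoning

sumAbove : ℕ → ℕ → ℕ
sumAbove j zero    = 0
sumAbove j (suc r) = suc j + sumAbove (suc j) r

sumAbove-closed : ∀ j r → suc j C 2 + sumAbove j r ≡ (suc j + r) C 2
sumAbove-closed j zero = trans (+-identityʳ _) (cong (_C 2) (sym (+-identityʳ (suc j))))
sumAbove-closed j (suc r) = begin
  suc j C 2 + (suc j + sumAbove (suc j) r) ≡⟨ +-assoc (suc j C 2) (suc j) _ ⟨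
  (suc j C 2 + suc j) + sumAbove (suc j) r ≡⟨ cong (_+ sumAbove (suc j) r) pascal ⟩
  suc (suc j) C 2 + sumAbove (suc j) r    ≡⟨ sumAbove-closed (suc j) r ⟩
  (suc (suc j) + r) C 2                   ≡⟨ cong (_C 2) (+-suc (suc j) r) ⟨
  (suc j + suc r) C 2                     ∎
  where
  open ≡-Reasoning
  pascal : suc j C 2 + suc j ≡ suc (suc j) C 2
  pascal = trans (+-comm (suc j C 2) _) (trans (cong (_+ suc j C 2) (sym (nC1≡n (suc j))))
                                                (nCk+nC[k+1]≡[n+1]C[k+1] (suc j) 1))

module _ (R : Fin m → Fin n → Bool) where

  commonNbhd : (Fin k → Fin m) → (Fin n → Bool) → Fin n → Bool
  commonNbhd {zero}  g W = W
  commonNbhd {suc k} g W = commonNbhd (g ∘ suc) (W ∩ R (g zero))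

  ∈-commonNbhd⁻ : ∀ (g : Fin k → Fin m) W {y} → y ∈ commonNbhd g W →
                  y ∈ W × (∀ a → R (g a) y ≡ true)
  ∈-commonNbhd⁻ {zero}  g W y∈N = y∈N , λ ()
  ∈-commonNbhd⁻ {suc k} g W y∈N
    with y∈W∩N₀ , adj ← ∈-commonNbhd⁻ (g ∘ suc) (W ∩ R (g zero)) y∈N
    with y∈W , adj₀ ← ∈-∩⁻ W (R (g zero)) y∈W∩N₀ = y∈W , λ { zero → adj₀ ; (suc a) → adj a }

  ∣commonNbhd∣ : ∀ (g : Fin k → Fin m) W {t} → (∀ a → ∣ W ∖ R (g a) ∣ < t) →
                 ∣ W ∣ + k ≤ ∣ commonNbhd g W ∣ + k * t
  ∣commonNbhd∣ {zero}  g W _ = ≤-refl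
  ∣commonNbhd∣ {suc k} g W {t} few = begin
    ∣ W ∣ + suc k                          ≡⟨ cong (_+ suc k) (∣A∣≡∣A∩B∣+∣A∖B∣ W (R (g zero))) ⟩
    (∣ W₀ ∣ + ∣ W ∖ R (g zero) ∣) + suc k   ≡⟨ swap-suc ∣ W₀ ∣ _ k ⟩
    (∣ W₀ ∣ + k) + suc ∣ W ∖ R (g zero) ∣   ≤⟨ +-mono-≤ (∣commonNbhd∣ (g ∘ suc) W₀ few₀) (few zero) ⟩
    (∣ commonNbhd g W ∣ + k * t) + t       ≡⟨ +-assoc _ (k * t) t ⟩
    ∣ commonNbhd g W ∣ + (k * t + t)       ≡⟨ cong (∣ commonNbhd g W ∣ +_) (+-comm (k * t) t) ⟩
    ∣ commonNbhd g W ∣ + suc k * t         ∎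
    where
    open ≤-Reasoning
    swap-suc : ∀ a b c → (a + b) + suc c ≡ (a + c) + suc b
    swap-suc = solve-∀
    W₀ : Fin n → Bool
    W₀ = W ∩ R (g zero)
    few₀ : ∀ a → ∣ W₀ ∖ R (g (suc a)) ∣ < t
    few₀ a = ≤-<-trans (p⊆q⇒∣p∣≤∣q∣ (∖-monoˡ (R (g (suc a))) (p∩q⊆p W (R (g zero)))))
                       (few (suc a))

  misses< : (Fin n → Bool) → ℕ → Fin m → Bool
  misses< W t x = ⌊ ∣ W ∖ R x ∣ <? t ⌋

  ∣misses<∣<ℓ : ∀ {ℓ} → ¬ InducedCopy (completeBipartite ℓ) (bipartite R) →
                ∀ W t → ℓ * t ≤ ∣ W ∣ → ∣ misses< W t ∣ < ℓ
  ∣misses<∣<ℓ {ℓ} no-Kℓℓ W t ℓt≤∣W∣ = ≰⇒> λ ℓ≤∣B∣ → no-Kℓℓ (biclique ℓ≤∣B∣)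
    where
    ℓ≤∣commonNbhd∣ : ∀ g → (∀ a → g a ∈ misses< W t) → ℓ ≤ ∣ commonNbhd g W ∣
    ℓ≤∣commonNbhd∣ g g∈B = +-cancelˡ-≤ (ℓ * t) _ _ (begin
      ℓ * t + ℓ                  ≤⟨ +-monoˡ-≤ ℓ ℓt≤∣W∣ ⟩
      ∣ W ∣ + ℓ                  ≤⟨ ∣commonNbhd∣ g W (λ a → ⌊⌋-sound (_ <? t) (g∈B a)) ⟩
      ∣ commonNbhd g W ∣ + ℓ * t ≡⟨ +-comm _ (ℓ * t) ⟩
      ℓ * t + ∣ commonNbhd g W ∣ ∎)
      where open ≤-Reasoning

    biclique : ℓ ≤ ∣ misses< W t ∣ → InducedCopy (completeBipartite ℓ) (bipartite R)
    biclique ℓ≤∣B∣ with g , g-inj , g∈B ← select ℓ (misses< W t) ℓ≤∣B∣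
      with h , h-inj , h∈N ← select ℓ (commonNbhd g W) (ℓ≤∣commonNbhd∣ g g∈B) =
      bipartiteCopy g h g-inj h-inj λ a b → proj₂ (∈-commonNbhd⁻ g W (h∈N b)) a

  record PartialMatching (j : ℕ) : Set where
    field
      centre  : Fin j → Fin m
      reserve : Fin j → Fin n → Bool
      free    : Fin n → Bool
      reserve-adj    : ∀ i {y} → y ∈ reserve i → R (centre i) y ≡ true
      reserve-nonadj : ∀ {i i′} → i ≢ i′ → ∀ {y} → y ∈ reserve i → R (centre i′) y ≡ false
      free-nonadj    : ∀ i {y} → y ∈ free → R (centre i) y ≡ false

  open PartialMatching

  emptyMatching : PartialMatching 0
  emptyMatching = record
    { centre = λ () ; reserve = λ () ; free = ⊤
    ; reserve-adj = λ () ; reserve-nonadj = λ { {()} } ; free-nonadj = λ () }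

  extend : PartialMatching j → Fin m → PartialMatching (suc j)
  extend {j} P x = record
    { centre  = centre′
    ; reserve = reserve′
    ; free    = free P ∖ R x
    ; reserve-adj    = reserve-adj′
    ; reserve-nonadj = reserve-nonadj′
    ; free-nonadj    = free-nonadj′
    }
    where
    centre′ : Fin (suc j) → Fin m
    centre′ = x ∷ centre P
    reserve′ : Fin (suc j) → Fin n → Bool
    reserve′ = free P ∩ R x ∷ (_∖ R x) ∘ reserve P
    reserve-adj′ : ∀ i {y} → y ∈ reserve′ i → R (centre′ i) y ≡ true
    reserve-adj′ zero    y∈ = proj₂ (∈-∩⁻ (free P) (R x) y∈)
    reserve-adj′ (suc i) y∈ = reserve-adj P i (proj₁ (∈-∖⁻ (reserve P i) (R x) y∈))
    reserve-nonadj′ : ∀ {i i′} → i ≢ i′ → ∀ {y} → y ∈ reserve′ i → R (centre′ i′) y ≡ false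
    reserve-nonadj′ {zero}  {zero}   0≢0  = contradiction refl 0≢0
    reserve-nonadj′ {zero}  {suc i′} _    y∈ = free-nonadj P i′ (proj₁ (∈-∩⁻ (free P) (R x) y∈))
    reserve-nonadj′ {suc i} {zero}   _    y∈ = proj₂ (∈-∖⁻ (reserve P i) (R x) y∈)
    reserve-nonadj′ {suc i} {suc i′} i≢i′ y∈ =
      reserve-nonadj P (i≢i′ ∘ cong suc) (proj₁ (∈-∖⁻ (reserve P i) (R x) y∈))
    free-nonadj′ : ∀ i {y} → y ∈ free P ∖ R x → R (centre′ i) y ≡ false
    free-nonadj′ zero    y∈ = proj₂ (∈-∖⁻ (free P) (R x) y∈)
    free-nonadj′ (suc i) y∈ = free-nonadj P i (proj₁ (∈-∖⁻ (free P) (R x) y∈))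

  inducedMatchingOf : (P : PartialMatching j) → (∀ i → 0 < ∣ reserve P i ∣) →
                      InducedCopy (matchingGraph j) (bipartite R)
  inducedMatchingOf P nonempty = inducedMatching (centre P) (proj₁ ∘ witness) matched
    where
    witness : ∀ i → ∃ (_∈ reserve P i)
    witness i = ∣∣>0⇒nonempty (reserve P i) (nonempty i)
    matched : ∀ a b → R (centre P a) (proj₁ (witness b)) ≡ ⌊ a ≟ b ⌋
    matched a b with a ≟ b
    ... | yes refl = reserve-adj P a (proj₂ (witness a))
    ... | no a≢b   = reserve-nonadj P (a≢b ∘ sym) (proj₂ (witness b))

  Rich : PartialMatching j → ℕ → Fin m → Set
  Rich P t x = t ≤ ∣ free P ∩ R x ∣ × (∀ i → t ≤ ∣ reserve P i ∖ R x ∣)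

  rich? : ∀ (P : PartialMatching j) t → Decidable (Rich P t)
  rich? P t x = (t ≤? _) ×-dec all? (λ i → t ≤? _)

  isRich : PartialMatching j → ℕ → Fin m → Bool
  isRich P t x = ⌊ rich? P t x ⌋

  extend-reserve-≥ : ∀ {t} (P : PartialMatching j) x → Rich P t x →
                     ∀ i → t ≤ ∣ reserve (extend P x) i ∣
  extend-reserve-≥ P x (t≤free , _)       zero    = t≤free
  extend-reserve-≥ P x (_ , t≤reserve) (suc i) = t≤reserve i

  ¬Rich⇒misses< : ∀ (P : PartialMatching j) {x* x t} → ∣ free P ∩ R x* ∣ ≤ ∣ free P ∩ R x ∣ →
                  ¬ Rich (extend P x*) t x → ∃ λ i → x ∈ misses< (reserve (extend P x*) i) t
  ¬Rich⇒misses< P {x*} {x} {t} x*-min ¬rich with t ≤? ∣ free P ∖ R x* ∩ R x ∣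
  ... | no t≰ = zero , ⌊⌋-complete (_ <? t)
                         (≤-<-trans (∣∩∖∣≤∣∖∩∣ (free P) (R x*) (R x) x*-min) (≰⇒> t≰))
  ... | yes t≤ with i , t≰ ← ¬∀⟶∃¬ _ _ (λ i → t ≤? _) (¬rich ∘ (t≤ ,_)) =
    i , ⌊⌋-complete (_ <? t) (≰⇒> t≰)

  module _ {ℓ} (no-Kℓℓ : ¬ InducedCopy (completeBipartite ℓ) (bipartite R)) where

    ∣¬Rich∣≤ : ∀ (P : PartialMatching j) (S : Fin m → Bool) {x* t} → Rich P (ℓ * t) x* →
               (∀ {x} → x ∈ S → ∣ free P ∩ R x* ∣ ≤ ∣ free P ∩ R x ∣) →
               ∣ S ∖ isRich (extend P x*) t ∣ ≤ suc j * pred ℓ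
    ∣¬Rich∣≤ P S {x*} {t} x*-rich x*-min =
      ∣∣-≤-cover (λ i → misses< (reserve (extend P x*) i) t) poor⇒misses<
        (λ i → <⇒≤pred (∣misses<∣<ℓ no-Kℓℓ _ t (extend-reserve-≥ P x* x*-rich i)))
      where
      poor⇒misses< : ∀ {x} → x ∈ S ∖ isRich (extend P x*) t →
                     ∃ λ i → x ∈ misses< (reserve (extend P x*) i) t
      poor⇒misses< x∈ with x∈S , poor ← ∈-∖⁻ S (isRich (extend P x*) t) x∈ =
        ¬Rich⇒misses< P (x*-min x∈S) (⌊⌋-false⇒¬ (rich? (extend P x*) t _) poor)

    growMatching : ∀ r (P : PartialMatching j) (S : Fin m → Bool) →
                   (∀ {x} → x ∈ S → Rich P (ℓ ^ r) x) → sumAbove j r * pred ℓ < ∣ S ∣ →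
                   InducedCopy (matchingGraph (j + suc r)) (bipartite R)
    growMatching {j} zero P S rich budget
      with x , x∈S ← ∣∣>0⇒nonempty S (≤-<-trans z≤n budget) =
      subst (λ d → InducedCopy (matchingGraph d) (bipartite R)) (+-comm 1 j)
        (inducedMatchingOf (extend P x) (extend-reserve-≥ P x (rich x∈S)))
    growMatching {j} (suc r) P S rich budget =
      subst (λ d → InducedCopy (matchingGraph d) (bipartite R)) (sym (+-suc j (suc r)))
        (growMatching r P′ S′ rich′ budget′)
      where
      x*-minimiser : Minimiser S (λ x → ∣ free P ∩ R x ∣)
      x*-minimiser =
        minimiser S (λ x → ∣ free P ∩ R x ∣) (proj₂ (∣∣>0⇒nonempty S (≤-<-trans z≤n budget)))
      x* : Fin m
      x* = proj₁ x*-minimiser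
      x*∈S : x* ∈ S
      x*∈S = proj₁ (proj₂ x*-minimiser)
      x*-min : ∀ {x} → x ∈ S → ∣ free P ∩ R x* ∣ ≤ ∣ free P ∩ R x ∣
      x*-min = proj₂ (proj₂ x*-minimiser)
      P′ : PartialMatching (suc j)
      P′ = extend P x*
      S′ : Fin m → Bool
      S′ = S ∩ isRich P′ (ℓ ^ r)
      rich′ : ∀ {x} → x ∈ S′ → Rich P′ (ℓ ^ r) x
      rich′ {x} x∈S′ = ⌊⌋-sound (rich? P′ (ℓ ^ r) x) (proj₂ (∈-∩⁻ S (isRich P′ (ℓ ^ r)) x∈S′))
      budget′ : sumAbove (suc j) r * pred ℓ < ∣ S′ ∣
      budget′ = +-cancelˡ-< (suc j * pred ℓ) _ _ (begin-strict
        suc j * pred ℓ + sumAbove (suc j) r * pred ℓ ≡⟨ *-distribʳ-+ (pred ℓ) (suc j) _ ⟨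
        sumAbove j (suc r) * pred ℓ                  <⟨ budget ⟩
        ∣ S ∣                                        ≡⟨ ∣A∣≡∣A∩B∣+∣A∖B∣ S (isRich P′ (ℓ ^ r)) ⟩
        ∣ S′ ∣ + ∣ S ∖ isRich P′ (ℓ ^ r) ∣           ≤⟨ +-monoʳ-≤ ∣ S′ ∣ poor-few ⟩
        ∣ S′ ∣ + suc j * pred ℓ                      ≡⟨ +-comm ∣ S′ ∣ _ ⟩
        suc j * pred ℓ + ∣ S′ ∣                      ∎)
        where
        open ≤-Reasoning
        poor-few : ∣ S ∖ isRich P′ (ℓ ^ r) ∣ ≤ suc j * pred ℓ
        poor-few = ∣¬Rich∣≤ P S (rich x*∈S) x*-min

lemma3p2 : (d ℓ : ℕ) → 2 ≤ d → 2 ≤ ℓ →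
    (m n : ℕ) → (R : Fin m → Fin n → Bool) →
    ¬ InducedCopy (matchingGraph d) (bipartite R) →
    ¬ InducedCopy (completeBipartite ℓ) (bipartite R) →
    (∀ x → ℓ ^ (d ∸ 1) ≤ degX R x) →
    m ≤ (d C 2) * (ℓ ∸ 1)
lemma3p2 (suc d) (suc ℓ) _ _ m n R no-dK₂ no-Kℓℓ deg =
  ≮⇒≥ λ many → no-dK₂ (growMatching R no-Kℓℓ d (emptyMatching R) ⊤ rich (budget many))
  where
  rich : ∀ {x} → x ∈ ⊤ → Rich R (emptyMatching R) (suc ℓ ^ d) x
  rich {x} _ = subst (suc ℓ ^ d ≤_) (degX≡∣R∣ R x) (deg x) , λ ()
  budget : (suc d C 2) * ℓ < m → sumAbove 0 d * ℓ < ∣ ⊤ {m} ∣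
  budget = subst₂ (λ a b → a * ℓ < b) (sym (sumAbove-closed 0 d)) (sym ∣⊤∣≡k)
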